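{- Let $a_1,\ldots,a_n$ and $b_1,\ldots,b_n$ be positive integers and let $f$ be a multiplicative function with $f(m)\ne 0$ for all positive integers $m$. If $\gcd(a_i,a_j)=\gcd(b_i,b_j)$ for all $1\le i<j\le n$, then $$\frac{\prod_{1\le i\le n}f(a_i)}{f(\mathrm{lcm}_{1\le i\le n}\{a_i\})}=\frac{\prod_{1\le i\le n}f(b_i)}{f(\mathrm{lcm}_{1\le i\le n}\{b_i\})}.$$ -}

module Defs where

open import Level using (_⊔_) renaming (suc to lsuc)
open import Data.Nat using (ℕ; zero; suc) renaming (_*_ to _*ℕ_)
open import Relation.Binary.PropositionalEquality using (_≡_)
open import Data.Nat.GCD using (gcd)
open import Data.Nat.LCM using (lcm)
open import Data.Fin using (Fin)
import Data.Fin as Fin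
open import Relation.Nullary using (¬_)
open import Algebra.Bundles using (CommutativeRing)

-- A field: a commutative ring with a total inverse operation _⁻¹ that is
-- a multiplicative inverse on every nonzero element, and 1 ≠ 0
-- (the usual convention 0⁻¹ is unspecified/irrelevant).
record Field c ℓ : Set (lsuc (c ⊔ ℓ)) where
  field
    commutativeRing : CommutativeRing c ℓ
  open CommutativeRing commutativeRing public
  field
    _⁻¹      : Carrier → Carrier
    inverse  : ∀ x → ¬ (x ≈ 0#) → x * (x ⁻¹) ≈ 1#
    0≉1      : ¬ (0# ≈ 1#)

  _÷_ : Carrier → Carrier → Carrier
  x ÷ y = x * (y ⁻¹)

lcmF : ∀ n → (Fin n → ℕ) → ℕ
lcmF zero    a = 1
lcmF (suc n) a = lcm (a Fin.zero) (lcmF n (λ i → a (Fin.suc i)))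

module _ {c ℓ} (K : Field c ℓ) where
  open Field K

  prodF : ∀ n → (Fin n → Carrier) → Carrier
  prodF zero    x = 1#
  prodF (suc n) x = x Fin.zero * prodF n (λ i → x (Fin.suc i))

  -- f is multiplicative (as an arithmetic function on the positive integers;
  -- the value f 0 is irrelevant): f(1) = 1 and f(mn) = f(m) f(n) whenever
  -- m, n are positive and coprime.
  record Multiplicative (f : ℕ → Carrier) : Set (c ⊔ ℓ) where
    field
      f1   : f 1 ≈ 1#
      fmul : ∀ m n → ¬ (m ≡ 0) → ¬ (n ≡ 0) → gcd m n ≡ 1 → f (m *ℕ n) ≈ f m * f n

module Submission where

-- For a family a₁,…,aₙ of positive integers put
--   overlapᵢ = gcd(aᵢ, lcm_{j>i} aⱼ).
-- Building the lcm up one member at a time with the identity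
--   f(x) f(y) = f(lcm(x,y)) f(gcd(x,y))                    (f multiplicative)
-- gives  ∏ f(aᵢ) = f(lcm aᵢ) · ∏ f(overlapᵢ),  so the quotient in the theorem
-- is ∏ f(overlapᵢ).  Since gcd distributes over lcm,
--   overlapᵢ = lcm_{j>i} gcd(aᵢ, aⱼ),
-- which only depends on the pairwise gcds; hence the quotients for a and b agree.
--
-- The two arithmetic facts (the f-identity and distributivity) are proved
-- prime by prime: every positive integer is p^α·u with p ∤ u, the p-part of a
-- gcd (lcm) is the minimum (maximum) of the p-parts, and an induction
-- principle over such splittings reduces both facts to min/max of exponents.

open import Function using (_∘_)
open import Data.Nat
  using (ℕ; zero; suc; _+_; _∸_; _*_; _^_; _⊓_; _⊔_; _≤_; _<_; s≤s; z≤n; z<s; ≢-nonZero; >-nonZero; ≢-nonZero⁻¹; nonTrivial⇒n>1)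
open import Data.Nat.Properties
  using ( *-identityˡ; *-zeroʳ; *-comm; *-assoc; *-cancelˡ-≡; *-commutativeSemigroup
        ; m*n≡0⇒m≡0∨n≡0; m<m*n; m^n≢0; ^-monoʳ-<; ^-distribˡ-+-*; m+[n∸m]≡n; ≤-total; <-irrefl; <-trans
        ; m≤n⇒m⊓n≡m; m≥n⇒m⊓n≡n; m≤n⇒m⊔n≡n; m≥n⇒m⊔n≡m; ⊓-distribˡ-⊔ )
open import Data.Nat.Divisibility using (_∣_; divides; _∣?_; ∣-trans; ∣-antisym; ∣1⇒≡1; ∣n⇒∣m*n)
open import Data.Nat.GCD
  using (gcd; gcd[m,n]∣m; gcd[m,n]∣n; gcd-greatest; gcd[m,n]≢0; gcd-comm; gcd-zeroˡ; gcd-zeroʳ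
        ; c*gcd[m,n]≡gcd[cm,cn])
open import Data.Nat.LCM using (lcm; gcd*lcm)
open import Data.Nat.Coprimality using (Coprime; coprime-divisor; coprime⇒gcd≡1)
import Data.Nat.Coprimality as Coprime
open import Data.Nat.Primality using (Prime; prime⇒irreducible; prime⇒nonZero; prime⇒nonTrivial; euclidsLemma)
open import Data.Nat.Primality.Factorisation using (factorise)
open import Data.Nat.ListAction using (product)
open import Data.Nat.Induction using (<-rec)
open import Data.List using ([]; _∷_)
open import Data.List.Relation.Unary.All using (_∷_)
open import Data.Product using (∃-syntax; _×_; _,_)
open import Data.Sum using (inj₁; inj₂; [_,_]′)
open import Data.Empty using (⊥-elim)
open import Relation.Nullary using (¬_; yes; no)
open import Relation.Binary.PropositionalEquality
  using (_≡_; _≢_; refl; sym; trans; cong; cong₂; subst; module ≡-Reasoning)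
open import Algebra.Bundles using (CommutativeSemigroup)
open import Data.Fin using (Fin; zero; suc)
import Data.Fin as Fin
open import Defs

min-max-product : ∀ {c ℓ} (S : CommutativeSemigroup c ℓ) (g : ℕ → CommutativeSemigroup.Carrier S) α β →
  CommutativeSemigroup._≈_ S (CommutativeSemigroup._∙_ S (g (α ⊓ β)) (g (α ⊔ β)))
                             (CommutativeSemigroup._∙_ S (g α) (g β))
min-max-product S g α β with ≤-total α β
... | inj₁ α≤β rewrite m≤n⇒m⊓n≡m α≤β | m≤n⇒m⊔n≡n α≤β = CommutativeSemigroup.refl S
... | inj₂ β≤α rewrite m≥n⇒m⊓n≡n β≤α | m≥n⇒m⊔n≡m β≤α = CommutativeSemigroup.comm S (g β) (g α)

module Arithmetic where
  open ≡-Reasoning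
  open import Algebra.Properties.CommutativeSemigroup *-commutativeSemigroup using (interchange)

  *-≢0 : ∀ {m n} → m ≢ 0 → n ≢ 0 → m * n ≢ 0
  *-≢0 {m} m≢0 n≢0 mn≡0 = [ m≢0 , n≢0 ]′ (m*n≡0⇒m≡0∨n≡0 m mn≡0)

  lcm-≢0 : ∀ {m n} → m ≢ 0 → n ≢ 0 → lcm m n ≢ 0
  lcm-≢0 {m} {n} m≢0 n≢0 l≡0 = *-≢0 m≢0 n≢0 (begin
    m * n             ≡⟨ sym (gcd*lcm m n) ⟩
    gcd m n * lcm m n ≡⟨ cong (gcd m n *_) l≡0 ⟩
    gcd m n * 0       ≡⟨ *-zeroʳ (gcd m n) ⟩
    0                 ∎)

  lcm-identityˡ : ∀ n → lcm 1 n ≡ n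
  lcm-identityˡ n = begin
    lcm 1 n           ≡⟨ sym (*-identityˡ (lcm 1 n)) ⟩
    1 * lcm 1 n       ≡⟨ cong (_* lcm 1 n) (sym (gcd-zeroˡ n)) ⟩
    gcd 1 n * lcm 1 n ≡⟨ gcd*lcm 1 n ⟩
    1 * n             ≡⟨ *-identityˡ n ⟩
    n                 ∎

  *-≢0⇒≢0ʳ : ∀ m {n} → m * n ≢ 0 → n ≢ 0
  *-≢0⇒≢0ʳ m mn≢0 refl = mn≢0 (*-zeroʳ m)

  lcm∣* : ∀ m n → lcm m n ∣ m * n
  lcm∣* m n = divides (gcd m n) (sym (gcd*lcm m n))

  coprime-*ˡ : ∀ {m o n} → Coprime m n → Coprime o n → Coprime (m * o) n
  coprime-*ˡ {m} cm co {d} (d∣mo , d∣n) = co (coprime-divisor d⊥m d∣mo , d∣n)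
    where
    d⊥m : Coprime d m
    d⊥m (e∣d , e∣m) = cm (e∣m , ∣-trans e∣d d∣n)

  coprime-^ˡ : ∀ {m n} k → Coprime m n → Coprime (m ^ k) n
  coprime-^ˡ zero    _   (d∣1 , _) = ∣1⇒≡1 d∣1
  coprime-^ˡ (suc k) m⊥n = coprime-*ˡ m⊥n (coprime-^ˡ k m⊥n)

  prime-coprime : ∀ {p n} → Prime p → ¬ p ∣ n → Coprime p n
  prime-coprime pp p∤n {d} (d∣p , d∣n) with prime⇒irreducible pp d∣p
  ... | inj₁ d≡1 = d≡1
  ... | inj₂ refl = ⊥-elim (p∤n d∣n)

  prime^-coprime : ∀ {p n} α → Prime p → ¬ p ∣ n → Coprime (p ^ α) n
  prime^-coprime α pp p∤n = coprime-^ˡ α (prime-coprime pp p∤n)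

  prime^-≢0 : ∀ {p} α → Prime p → p ^ α ≢ 0
  prime^-≢0 {p} α pp = ≢-nonZero⁻¹ (p ^ α) {{m^n≢0 p α {{prime⇒nonZero pp}}}}

  gcd-drop-coprime : ∀ {m k} n → Coprime m k → gcd m (k * n) ≡ gcd m n
  gcd-drop-coprime {m} {k} n m⊥k = ∣-antisym
    (gcd-greatest (gcd[m,n]∣m m (k * n)) (coprime-divisor g⊥k (gcd[m,n]∣n m (k * n))))
    (gcd-greatest (gcd[m,n]∣m m n) (∣n⇒∣m*n k (gcd[m,n]∣n m n)))
    where
    g⊥k : Coprime (gcd m (k * n)) k
    g⊥k (e∣g , e∣k) = m⊥k (∣-trans e∣g (gcd[m,n]∣m m (k * n)) , e∣k)

  p∤gcd : ∀ {p u} v → ¬ p ∣ u → ¬ p ∣ gcd u v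
  p∤gcd {u = u} v p∤u p∣g = p∤u (∣-trans p∣g (gcd[m,n]∣m u v))

  p∤lcm : ∀ {p u v} → Prime p → ¬ p ∣ u → ¬ p ∣ v → ¬ p ∣ lcm u v
  p∤lcm {u = u} {v} pp p∤u p∤v p∣l =
    [ p∤u , p∤v ]′ (euclidsLemma u v pp (∣-trans p∣l (lcm∣* u v)))

  gcd-p-split≤ : ∀ p {α β u v} → Prime p → ¬ p ∣ u → α ≤ β →
                 gcd (p ^ α * u) (p ^ β * v) ≡ p ^ α * gcd u v
  gcd-p-split≤ p {α} {β} {u} {v} pp p∤u α≤β = begin
    gcd (p ^ α * u) (p ^ β * v)
      ≡⟨ cong (λ e → gcd (p ^ α * u) (p ^ e * v)) (sym (m+[n∸m]≡n α≤β)) ⟩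
    gcd (p ^ α * u) (p ^ (α + (β ∸ α)) * v)
      ≡⟨ cong (λ x → gcd (p ^ α * u) (x * v)) (^-distribˡ-+-* p α (β ∸ α)) ⟩
    gcd (p ^ α * u) (p ^ α * p ^ (β ∸ α) * v)
      ≡⟨ cong (gcd (p ^ α * u)) (*-assoc (p ^ α) _ v) ⟩
    gcd (p ^ α * u) (p ^ α * (p ^ (β ∸ α) * v))
      ≡⟨ sym (c*gcd[m,n]≡gcd[cm,cn] (p ^ α) u _) ⟩
    p ^ α * gcd u (p ^ (β ∸ α) * v)
      ≡⟨ cong (p ^ α *_) (gcd-drop-coprime v (Coprime.sym (prime^-coprime (β ∸ α) pp p∤u))) ⟩
    p ^ α * gcd u v ∎

  gcd-p-split : ∀ p {α β u v} → Prime p → ¬ p ∣ u → ¬ p ∣ v →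
                gcd (p ^ α * u) (p ^ β * v) ≡ p ^ (α ⊓ β) * gcd u v
  gcd-p-split p {α} {β} {u} {v} pp p∤u p∤v with ≤-total α β
  ... | inj₁ α≤β rewrite m≤n⇒m⊓n≡m α≤β = gcd-p-split≤ p pp p∤u α≤β
  ... | inj₂ β≤α rewrite m≥n⇒m⊓n≡n β≤α = begin
    gcd (p ^ α * u) (p ^ β * v) ≡⟨ gcd-comm (p ^ α * u) (p ^ β * v) ⟩
    gcd (p ^ β * v) (p ^ α * u) ≡⟨ gcd-p-split≤ p pp p∤v β≤α ⟩
    p ^ β * gcd v u             ≡⟨ cong (p ^ β *_) (gcd-comm v u) ⟩
    p ^ β * gcd u v             ∎

  -- Dually, the p-adic valuation of an lcm is the maximum; derived from the
  -- gcd case through gcd · lcm = product.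
  lcm-p-split : ∀ p {α β u v} → Prime p → u ≢ 0 → ¬ p ∣ u → ¬ p ∣ v →
                lcm (p ^ α * u) (p ^ β * v) ≡ p ^ (α ⊔ β) * lcm u v
  lcm-p-split p {α} {β} {u} {v} pp u≢0 p∤u p∤v =
    *-cancelˡ-≡ _ _ (gcd x y) {{≢-nonZero g≢0}} (begin
      gcd x y * lcm x y
        ≡⟨ gcd*lcm x y ⟩
      x * y
        ≡⟨ interchange (p ^ α) u (p ^ β) v ⟩
      p ^ α * p ^ β * (u * v)
        ≡⟨ cong₂ _*_ (sym (min-max-product *-commutativeSemigroup (p ^_) α β)) (sym (gcd*lcm u v)) ⟩
      p ^ (α ⊓ β) * p ^ (α ⊔ β) * (gcd u v * lcm u v)
        ≡⟨ interchange (p ^ (α ⊓ β)) (p ^ (α ⊔ β)) (gcd u v) (lcm u v) ⟩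
      p ^ (α ⊓ β) * gcd u v * (p ^ (α ⊔ β) * lcm u v)
        ≡⟨ cong (_* (p ^ (α ⊔ β) * lcm u v)) (sym (gcd-p-split p {α} {β} pp p∤u p∤v)) ⟩
      gcd x y * (p ^ (α ⊔ β) * lcm u v) ∎)
    where
    x y : ℕ
    x = p ^ α * u
    y = p ^ β * v
    g≢0 : gcd x y ≢ 0
    g≢0 = gcd[m,n]≢0 x y (inj₁ (*-≢0 (prime^-≢0 α pp) u≢0))

  record PSplitting (p x : ℕ) : Set where
    constructor psplitting
    field
      valuation : ℕ
      cofactor  : ℕ
      splits    : x ≡ p ^ valuation * cofactor
      p∤cofactor : ¬ p ∣ cofactor
  open PSplitting

  p-splitting : ∀ {p} → Prime p → ∀ x → x ≢ 0 → PSplitting p x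
  p-splitting {p} pp = <-rec (λ x → x ≢ 0 → PSplitting p x) split
    where
    split : ∀ x → (∀ {y} → y < x → y ≢ 0 → PSplitting p y) → x ≢ 0 → PSplitting p x
    split x rec x≢0 with p ∣? x
    ... | no p∤x = psplitting 0 x (sym (*-identityˡ x)) p∤x
    ... | yes (divides q x≡q*p) = extend (rec q<x q≢0)
      where
      q≢0 : q ≢ 0
      q≢0 refl = x≢0 x≡q*p
      q<x : q < x
      q<x = subst (q <_) (sym x≡q*p)
              (m<m*n q p {{≢-nonZero q≢0}} (nonTrivial⇒n>1 p {{prime⇒nonTrivial pp}}))
      extend : PSplitting p q → PSplitting p x
      extend (psplitting α u q≡ p∤u) = psplitting (suc α) u (begin
        x             ≡⟨ x≡q*p ⟩
        q * p         ≡⟨ *-comm q p ⟩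
        p * q         ≡⟨ cong (p *_) q≡ ⟩
        p * (p ^ α * u) ≡⟨ sym (*-assoc p (p ^ α) u) ⟩
        p ^ suc α * u ∎) p∤u

  cofactor-≢0 : ∀ {p x} → x ≢ 0 → (s : PSplitting p x) → cofactor s ≢ 0
  cofactor-≢0 x≢0 (psplitting α u x≡ _) refl = x≢0 (trans x≡ (*-zeroʳ (_ ^ α)))

  cofactor-< : ∀ {p x} → Prime p → x ≢ 0 → p ∣ x → (s : PSplitting p x) → cofactor s < x
  cofactor-< {p} pp x≢0 p∣x (psplitting zero u x≡ p∤u) =
    ⊥-elim (p∤u (subst (p ∣_) (trans x≡ (*-identityˡ u)) p∣x))
  cofactor-< {p} pp x≢0 p∣x s@(psplitting (suc α) u x≡ _) =
    subst (u <_) (trans (*-comm u (p ^ suc α)) (sym x≡))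
      (m<m*n u (p ^ suc α) {{≢-nonZero (cofactor-≢0 x≢0 s)}}
        (^-monoʳ-< p (nonTrivial⇒n>1 p {{prime⇒nonTrivial pp}}) {0} {suc α} (s≤s z≤n)))

  prime-factor : ∀ x → 1 < x → ∃[ p ] Prime p × p ∣ x
  prime-factor x 1<x with factorise x {{>-nonZero (<-trans z<s 1<x)}}
  ... | record { factors = [] ; isFactorisation = x≡1 } = ⊥-elim (<-irrefl (sym x≡1) 1<x)
  ... | record { factors = p ∷ ps ; isFactorisation = x≡ ; factorsPrime = pp ∷ _ } =
    p , pp , divides (product ps) (trans x≡ (*-comm p (product ps)))

  prime-induction : ∀ {ℓ} (P : ℕ → Set ℓ) → P 1 →
    (∀ {p u} α → Prime p → u ≢ 0 → ¬ p ∣ u → P u → P (p ^ α * u)) →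
    ∀ x → x ≢ 0 → P x
  prime-induction P P1 step = <-rec (λ x → x ≢ 0 → P x) go
    where
    go : ∀ x → (∀ {y} → y < x → y ≢ 0 → P y) → x ≢ 0 → P x
    go zero          _   0≢0 = ⊥-elim (0≢0 refl)
    go 1             _   _   = P1
    go x@(suc (suc _)) rec x≢0 with prime-factor x (s≤s (s≤s z≤n))
    ... | p , pp , p∣x = subst P (sym (splits s))
          (step (valuation s) pp u≢0 (p∤cofactor s) (rec (cofactor-< pp x≢0 p∣x s) u≢0))
      where
      s : PSplitting p x
      s = p-splitting pp x x≢0
      u≢0 : cofactor s ≢ 0
      u≢0 = cofactor-≢0 x≢0 s

  -- gcd distributes over lcm on positive integers: prime by prime this is
  -- min(α, max(β, γ)) = max(min(α, β), min(α, γ)).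
  gcd-distribˡ-lcm : ∀ a b c → a ≢ 0 → b ≢ 0 → c ≢ 0 →
                     gcd a (lcm b c) ≡ lcm (gcd a b) (gcd a c)
  gcd-distribˡ-lcm a b c a≢0 = prime-induction Distributes base step a a≢0 b c
    where
    Distributes : ℕ → Set
    Distributes a = ∀ b c → b ≢ 0 → c ≢ 0 → gcd a (lcm b c) ≡ lcm (gcd a b) (gcd a c)

    base : Distributes 1
    base b c _ _ rewrite gcd-zeroˡ (lcm b c) | gcd-zeroˡ b | gcd-zeroˡ c = refl

    step : ∀ {p u} α → Prime p → u ≢ 0 → ¬ p ∣ u → Distributes u → Distributes (p ^ α * u)
    step {p} {u} α pp u≢0 p∤u ih b c b≢0 c≢0
      with p-splitting pp b b≢0 | p-splitting pp c c≢0
    ... | psplitting β v refl p∤v | psplitting γ w refl p∤w = begin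
      gcd (p ^ α * u) (lcm (p ^ β * v) (p ^ γ * w))
        ≡⟨ cong (gcd (p ^ α * u)) (lcm-p-split p {β} {γ} pp v≢0 p∤v p∤w) ⟩
      gcd (p ^ α * u) (p ^ (β ⊔ γ) * lcm v w)
        ≡⟨ gcd-p-split p {α} {β ⊔ γ} pp p∤u (p∤lcm pp p∤v p∤w) ⟩
      p ^ (α ⊓ (β ⊔ γ)) * gcd u (lcm v w)
        ≡⟨ cong₂ (λ e x → p ^ e * x) (⊓-distribˡ-⊔ α β γ) (ih v w v≢0 w≢0) ⟩
      p ^ ((α ⊓ β) ⊔ (α ⊓ γ)) * lcm (gcd u v) (gcd u w)
        ≡⟨ sym (lcm-p-split p {α ⊓ β} {α ⊓ γ} pp (gcd[m,n]≢0 u v (inj₁ u≢0)) (p∤gcd v p∤u) (p∤gcd w p∤u)) ⟩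
      lcm (p ^ (α ⊓ β) * gcd u v) (p ^ (α ⊓ γ) * gcd u w)
        ≡⟨ sym (cong₂ lcm (gcd-p-split p {α} {β} pp p∤u p∤v) (gcd-p-split p {α} {γ} pp p∤u p∤w)) ⟩
      lcm (gcd (p ^ α * u) (p ^ β * v)) (gcd (p ^ α * u) (p ^ γ * w)) ∎
      where
      v≢0 : v ≢ 0
      v≢0 = *-≢0⇒≢0ʳ (p ^ β) b≢0
      w≢0 : w ≢ 0
      w≢0 = *-≢0⇒≢0ʳ (p ^ γ) c≢0

open Arithmetic

lcmF-≢0 : ∀ n (a : Fin n → ℕ) → (∀ i → a i ≢ 0) → lcmF n a ≢ 0
lcmF-≢0 zero    a a≢0 ()
lcmF-≢0 (suc n) a a≢0 = lcm-≢0 (a≢0 zero) (lcmF-≢0 n (a ∘ suc) (a≢0 ∘ suc))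

lcmF-cong : ∀ n {a b : Fin n → ℕ} → (∀ i → a i ≡ b i) → lcmF n a ≡ lcmF n b
lcmF-cong zero    a≡b = refl
lcmF-cong (suc n) a≡b = cong₂ lcm (a≡b zero) (lcmF-cong n (a≡b ∘ suc))

gcd-distribˡ-lcmF : ∀ n x (a : Fin n → ℕ) → x ≢ 0 → (∀ i → a i ≢ 0) →
                    gcd x (lcmF n a) ≡ lcmF n (λ i → gcd x (a i))
gcd-distribˡ-lcmF zero    x a x≢0 a≢0 = gcd-zeroʳ x
gcd-distribˡ-lcmF (suc n) x a x≢0 a≢0 = trans
  (gcd-distribˡ-lcm x (a zero) (lcmF n (a ∘ suc)) x≢0 (a≢0 zero) (lcmF-≢0 n (a ∘ suc) (a≢0 ∘ suc)))
  (cong (lcm (gcd x (a zero))) (gcd-distribˡ-lcmF n x (a ∘ suc) x≢0 (a≢0 ∘ suc)))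

-- The i-th overlap of a family: gcd(aᵢ, lcm_{j>i} aⱼ), the part of aᵢ already
-- accounted for by the later members when the lcm is built up.
overlapF : ∀ n → (Fin n → ℕ) → Fin n → ℕ
overlapF (suc n) a zero    = gcd (a zero) (lcmF n (a ∘ suc))
overlapF (suc n) a (suc i) = overlapF n (a ∘ suc) i

-- By distributivity, overlapᵢ = lcm_{j>i} gcd(aᵢ, aⱼ): the overlaps only
-- depend on the pairwise gcds.
overlapF-pairwise : ∀ n (a b : Fin n → ℕ) → (∀ i → a i ≢ 0) → (∀ i → b i ≢ 0) →
  (∀ i j → i Fin.< j → gcd (a i) (a j) ≡ gcd (b i) (b j)) →
  ∀ i → overlapF n a i ≡ overlapF n b i
overlapF-pairwise (suc n) a b a≢0 b≢0 gcds zero = begin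
  gcd (a zero) (lcmF n (a ∘ suc))            ≡⟨ gcd-distribˡ-lcmF n (a zero) (a ∘ suc) (a≢0 zero) (a≢0 ∘ suc) ⟩
  lcmF n (λ j → gcd (a zero) (a (suc j)))    ≡⟨ lcmF-cong n (λ j → gcds zero (suc j) (s≤s z≤n)) ⟩
  lcmF n (λ j → gcd (b zero) (b (suc j)))    ≡⟨ sym (gcd-distribˡ-lcmF n (b zero) (b ∘ suc) (b≢0 zero) (b≢0 ∘ suc)) ⟩
  gcd (b zero) (lcmF n (b ∘ suc))            ∎
  where open ≡-Reasoning
overlapF-pairwise (suc n) a b a≢0 b≢0 gcds (suc i) =
  overlapF-pairwise n (a ∘ suc) (b ∘ suc) (a≢0 ∘ suc) (b≢0 ∘ suc)
    (λ i j i<j → gcds (suc i) (suc j) (s≤s i<j)) i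

module MultiplicativeFunctions {c ℓ} (K : Field c ℓ) {f : ℕ → Field.Carrier K} (mult : Multiplicative K f) where
  open Field K using (Carrier; _≈_; 0#; 1#; _⁻¹; _÷_; inverse) renaming (_*_ to _·_)
  module K = Field K
  open Multiplicative mult
  open import Relation.Binary.Reasoning.Setoid K.setoid
  open import Algebra.Properties.CommutativeSemigroup K.*-commutativeSemigroup using (interchange)

  f-p-split : ∀ {p} α {u} → Prime p → u ≢ 0 → ¬ p ∣ u → f (p ^ α * u) ≈ f (p ^ α) · f u
  f-p-split α pp u≢0 p∤u =
    fmul _ _ (prime^-≢0 α pp) u≢0 (coprime⇒gcd≡1 (prime^-coprime α pp p∤u))

  -- The basic identity f(x) f(y) = f(lcm(x,y)) f(gcd(x,y)): prime by prime it
  -- is f(p^α) f(p^β) = f(p^max) f(p^min).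
  f-lcm-gcd : ∀ x y → x ≢ 0 → y ≢ 0 → f x · f y ≈ f (lcm x y) · f (gcd x y)
  f-lcm-gcd x y x≢0 = prime-induction LcmGcd base step x x≢0 y
    where
    LcmGcd : ℕ → Set ℓ
    LcmGcd x = ∀ y → y ≢ 0 → f x · f y ≈ f (lcm x y) · f (gcd x y)

    base : LcmGcd 1
    base y _ rewrite lcm-identityˡ y | gcd-zeroˡ y = K.*-comm (f 1) (f y)

    step : ∀ {p u} α → Prime p → u ≢ 0 → ¬ p ∣ u → LcmGcd u → LcmGcd (p ^ α * u)
    step {p} {u} α pp u≢0 p∤u ih y y≢0 with p-splitting pp y y≢0
    ... | psplitting β v refl p∤v = begin
      f (p ^ α * u) · f (p ^ β * v)
        ≈⟨ K.*-cong (f-p-split α pp u≢0 p∤u) (f-p-split β pp v≢0 p∤v) ⟩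
      (f (p ^ α) · f u) · (f (p ^ β) · f v)
        ≈⟨ interchange _ _ _ _ ⟩
      (f (p ^ α) · f (p ^ β)) · (f u · f v)
        ≈⟨ K.*-cong (K.sym (min-max-product K.*-commutativeSemigroup (f ∘ (p ^_)) α β)) (ih v v≢0) ⟩
      (f (p ^ (α ⊓ β)) · f (p ^ (α ⊔ β))) · (f (lcm u v) · f (gcd u v))
        ≈⟨ K.*-cong (K.*-comm _ _) K.refl ⟩
      (f (p ^ (α ⊔ β)) · f (p ^ (α ⊓ β))) · (f (lcm u v) · f (gcd u v))
        ≈⟨ interchange _ _ _ _ ⟩
      (f (p ^ (α ⊔ β)) · f (lcm u v)) · (f (p ^ (α ⊓ β)) · f (gcd u v))
        ≈⟨ K.sym (K.*-cong (f-p-split (α ⊔ β) pp (lcm-≢0 u≢0 v≢0) (p∤lcm pp p∤u p∤v))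
                           (f-p-split (α ⊓ β) pp (gcd[m,n]≢0 u v (inj₁ u≢0)) (p∤gcd v p∤u))) ⟩
      f (p ^ (α ⊔ β) * lcm u v) · f (p ^ (α ⊓ β) * gcd u v)
        ≡⟨ sym (cong₂ (λ l g → f l · f g) (lcm-p-split p {α} {β} pp u≢0 p∤u p∤v)
                                          (gcd-p-split p {α} {β} pp p∤u p∤v)) ⟩
      f (lcm (p ^ α * u) (p ^ β * v)) · f (gcd (p ^ α * u) (p ^ β * v)) ∎
      where
      v≢0 : v ≢ 0
      v≢0 = *-≢0⇒≢0ʳ (p ^ β) y≢0

  prodF-cong : ∀ n {x y : Fin n → Carrier} → (∀ i → x i ≈ y i) → prodF K n x ≈ prodF K n y
  prodF-cong zero    x≈y = K.refl
  prodF-cong (suc n) x≈y = K.*-cong (x≈y zero) (prodF-cong n (x≈y ∘ suc))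

  prodF-lcm-overlaps : ∀ n (a : Fin n → ℕ) → (∀ i → a i ≢ 0) →
    prodF K n (λ i → f (a i)) ≈ f (lcmF n a) · prodF K n (λ i → f (overlapF n a i))
  prodF-lcm-overlaps zero    a a≢0 = K.sym (K.trans (K.*-identityʳ (f 1)) f1)
  prodF-lcm-overlaps (suc n) a a≢0 = begin
    f (a zero) · prodF K n (λ i → f (a (suc i)))
      ≈⟨ K.*-cong K.refl (prodF-lcm-overlaps n (a ∘ suc) (a≢0 ∘ suc)) ⟩
    f (a zero) · (f L · O)
      ≈⟨ K.sym (K.*-assoc _ _ _) ⟩
    (f (a zero) · f L) · O
      ≈⟨ K.*-cong (f-lcm-gcd (a zero) L (a≢0 zero) (lcmF-≢0 n (a ∘ suc) (a≢0 ∘ suc))) K.refl ⟩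
    (f (lcm (a zero) L) · f (gcd (a zero) L)) · O
      ≈⟨ K.*-assoc _ _ _ ⟩
    f (lcm (a zero) L) · (f (gcd (a zero) L) · O) ∎
    where
    L : ℕ
    L = lcmF n (a ∘ suc)
    O : Carrier
    O = prodF K n (λ i → f (overlapF n (a ∘ suc) i))

  ·-÷-cancelˡ : ∀ x y → ¬ x ≈ 0# → (x · y) ÷ x ≈ y
  ·-÷-cancelˡ x y x≉0 = begin
    (x · y) · x ⁻¹ ≈⟨ K.*-cong (K.*-comm x y) K.refl ⟩
    (y · x) · x ⁻¹ ≈⟨ K.*-assoc y x (x ⁻¹) ⟩
    y · (x · x ⁻¹) ≈⟨ K.*-cong K.refl (inverse x x≉0) ⟩
    y · 1#         ≈⟨ K.*-identityʳ y ⟩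
    y              ∎

  quotient-overlaps : (∀ m → m ≢ 0 → ¬ f m ≈ 0#) → ∀ n (a : Fin n → ℕ) → (∀ i → a i ≢ 0) →
    prodF K n (λ i → f (a i)) ÷ f (lcmF n a) ≈ prodF K n (λ i → f (overlapF n a i))
  quotient-overlaps f≉0 n a a≢0 = begin
    prodF K n (λ i → f (a i)) ÷ f (lcmF n a)
      ≈⟨ K.*-cong (prodF-lcm-overlaps n a a≢0) K.refl ⟩
    (f (lcmF n a) · prodF K n (λ i → f (overlapF n a i))) ÷ f (lcmF n a)
      ≈⟨ ·-÷-cancelˡ _ _ (f≉0 _ (lcmF-≢0 n a a≢0)) ⟩
    prodF K n (λ i → f (overlapF n a i)) ∎

lemma2p3 : ∀ {c ℓ} (K : Field c ℓ) (f : ℕ → Field.Carrier K) →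
    Multiplicative K f →
    (∀ m → ¬ (m ≡ 0) → ¬ (Field._≈_ K (f m) (Field.0# K))) →
    (n : ℕ) (a b : Fin n → ℕ) →
    (∀ i → ¬ (a i ≡ 0)) → (∀ i → ¬ (b i ≡ 0)) →
    (∀ i j → i Fin.< j → gcd (a i) (a j) ≡ gcd (b i) (b j)) →
    Field._≈_ K
      (Field._÷_ K (prodF K n (λ i → f (a i))) (f (lcmF n a)))
      (Field._÷_ K (prodF K n (λ i → f (b i))) (f (lcmF n b)))
lemma2p3 K f mult f≉0 n a b a≢0 b≢0 gcds = begin
  prodF K n (λ i → f (a i)) ÷ f (lcmF n a) ≈⟨ quotient-overlaps f≉0 n a a≢0 ⟩
  prodF K n (λ i → f (overlapF n a i))    ≈⟨ prodF-cong n (λ i → K.reflexive (cong f (same-overlaps i))) ⟩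
  prodF K n (λ i → f (overlapF n b i))    ≈⟨ K.sym (quotient-overlaps f≉0 n b b≢0) ⟩
  prodF K n (λ i → f (b i)) ÷ f (lcmF n b) ∎
  where
  open MultiplicativeFunctions K mult
  open Field K using (_÷_)
  open import Relation.Binary.Reasoning.Setoid K.setoid
  same-overlaps : ∀ i → overlapF n a i ≡ overlapF n b i
  same-overlaps = overlapF-pairwise n a b a≢0 b≢0 gcds
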